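{- Let $p$ and $q$ be relatively prime integers with $q \ge 2$. Then for every positive integer $n$, $$\left[\frac{np}{q}\right] - \sum_{k=1}^{n} \frac{[kp/q]}{k} < \left[\frac{(n+q)p}{q}\right] - \sum_{k=1}^{n+q} \frac{[kp/q]}{k}.$$
   Context: $[t]$ denotes the greatest integer less than or equal to $t$. -}

module Defs where

open import Data.Nat as ℕ using (ℕ; zero; suc)
open import Data.Integer as ℤ using (ℤ; +_)
open import Data.Rational as ℚ using (ℚ; floor; _/_)

flr : ℤ → (q : ℕ) → .{{_ : ℕ.NonZero q}} → ℤ
flr x q = floor (x / q)

S : ℤ → (q : ℕ) → .{{_ : ℕ.NonZero q}} → ℕ → ℚ
S p q zero = ℚ.0ℚ
S p q (suc n) = S p q n ℚ.+ (flr (+ suc n ℤ.* p) q / suc n)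

F : ℤ → (q : ℕ) → .{{_ : ℕ.NonZero q}} → ℕ → ℚ
F p q n = (flr (+ n ℤ.* p) q / 1) ℚ.- S p q n

{-# OPTIONS --safe #-}
-- Passing from n to n + q adds exactly p to [np/q], whereas each of the q new summands
-- [kp/q]/k, n < k ≤ n + q, is at most p/q, with equality only if q ∣ kp, i.e. q ∣ k by
-- coprimality.  As q ≥ 2, one of n + 1 and n + 2 is not a multiple of q, so the sum
-- grows by strictly less than p.
module Submission where

open import Defs
open import Data.Nat as ℕ using (ℕ; suc; _+_; _≥_)
open import Data.Integer as ℤ using (ℤ; +_)
open import Data.Integer.Coprimality using (Coprime)
open import Data.Rational using (_<_)

import Data.Nat.Properties as ℕP
import Data.Nat.Divisibility as ℕ
open import Data.Nat.GCD using (gcd[m,n]≢0)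
import Data.Integer.Properties as ℤP
import Data.Integer.Coprimality as Coprimality
open import Data.Integer.Divisibility using () renaming (_∣_ to _∣ℤ_)
open import Data.Integer.DivMod using ([n/d]*d≤n; n<s[n/ℕd]*d; div-pos-is-/ℕ)
open import Data.Integer.GCD using (gcd)
open import Data.Integer.Tactic.RingSolver using (solve-∀)
open import Data.Rational as ℚ using (mkℚ; floor; ↥_; ↧_; _/_)
open import Data.Rational.Properties as ℚP
  using (toℚᵘ-fromℚᵘ; fromℚᵘ-cong; toℚᵘ-injective; toℚᵘ-cancel-≤; toℚᵘ-cancel-<; toℚᵘ-homo-+)
open import Data.Rational.Solver using (module +-*-Solver)
open import Data.Rational.Unnormalised as ℚᵘ using (mkℚᵘ)
import Data.Rational.Unnormalised.Properties as ℚᵘP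
open import Data.Product using (∃-syntax; _×_; _,_)
open import Data.Sum using (_⊎_; inj₁; inj₂)
open import Relation.Binary.PropositionalEquality
open import Relation.Nullary using (¬_; yes; no)

*≤*⇒/≤/ : ∀ i j {k l} .{{_ : ℕ.NonZero k}} .{{_ : ℕ.NonZero l}} →
          i ℤ.* + l ℤ.≤ j ℤ.* + k → i / k ℚ.≤ j / l
*≤*⇒/≤/ i j {suc k} {suc l} h = toℚᵘ-cancel-≤
  (ℚᵘP.≤-respʳ-≃ (ℚᵘP.≃-sym (toℚᵘ-fromℚᵘ (mkℚᵘ j l)))
    (ℚᵘP.≤-respˡ-≃ (ℚᵘP.≃-sym (toℚᵘ-fromℚᵘ (mkℚᵘ i k))) (ℚᵘ.*≤* h)))

*<*⇒/</ : ∀ i j {k l} .{{_ : ℕ.NonZero k}} .{{_ : ℕ.NonZero l}} →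
          i ℤ.* + l ℤ.< j ℤ.* + k → i / k ℚ.< j / l
*<*⇒/</ i j {suc k} {suc l} h = toℚᵘ-cancel-<
  (ℚᵘP.<-respʳ-≃ (ℚᵘP.≃-sym (toℚᵘ-fromℚᵘ (mkℚᵘ j l)))
    (ℚᵘP.<-respˡ-≃ (ℚᵘP.≃-sym (toℚᵘ-fromℚᵘ (mkℚᵘ i k))) (ℚᵘ.*<* h)))

*≡*⇒/≡/ : ∀ i j {k l} .{{_ : ℕ.NonZero k}} .{{_ : ℕ.NonZero l}} →
          i ℤ.* + l ≡ j ℤ.* + k → i / k ≡ j / l
*≡*⇒/≡/ i j {suc k} {suc l} h = fromℚᵘ-cong {mkℚᵘ i k} {mkℚᵘ j l} (ℚᵘ.*≡* h)

/-distribʳ-+ : ∀ i j k .{{_ : ℕ.NonZero k}} → (i ℤ.+ j) / k ≡ i / k ℚ.+ j / k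
/-distribʳ-+ i j (suc k) = toℚᵘ-injective (begin
  ℚ.toℚᵘ ((i ℤ.+ j) / suc k)                 ≈⟨ toℚᵘ-fromℚᵘ (mkℚᵘ (i ℤ.+ j) k) ⟩
  mkℚᵘ (i ℤ.+ j) k                           ≈⟨ ℚᵘ.*≡* (cross i j (+ suc k)) ⟩
  mkℚᵘ i k ℚᵘ.+ mkℚᵘ j k                     ≈⟨ ℚᵘP.+-cong (toℚᵘ-fromℚᵘ (mkℚᵘ i k))
                                                             (toℚᵘ-fromℚᵘ (mkℚᵘ j k)) ⟨
  ℚ.toℚᵘ (i / suc k) ℚᵘ.+ ℚ.toℚᵘ (j / suc k) ≈⟨ toℚᵘ-homo-+ (i / suc k) (j / suc k) ⟨
  ℚ.toℚᵘ (i / suc k ℚ.+ j / suc k)           ∎)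
  where
  open ℚᵘP.≃-Reasoning
  cross : ∀ a b d → (a ℤ.+ b) ℤ.* (d ℤ.* d) ≡ (a ℤ.* d ℤ.+ b ℤ.* d) ℤ.* d
  cross = solve-∀

k*i/k≡i : ∀ i k .{{_ : ℕ.NonZero k}} → (+ k ℤ.* i) / k ≡ i / 1
k*i/k≡i i k = *≡*⇒/≡/ (+ k ℤ.* i) i (swap (+ k) i)
  where
  swap : ∀ k i → k ℤ.* i ℤ.* + 1 ≡ i ℤ.* k
  swap = solve-∀

floor*↧≤↥ : ∀ r → floor r ℤ.* ↧ r ℤ.≤ ↥ r
floor*↧≤↥ (mkℚ n d _) = [n/d]*d≤n n (+ suc d)

↥<suc[floor]*↧ : ∀ r → ↥ r ℤ.< ℤ.suc (floor r) ℤ.* ↧ r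
↥<suc[floor]*↧ (mkℚ n d _) =
  subst (λ f → n ℤ.< ℤ.suc f ℤ.* + suc d) (sym (div-pos-is-/ℕ n (suc d))) (n<s[n/ℕd]*d n (suc d))

module _ (x : ℤ) (q : ℕ) .{{_ : ℕ.NonZero q}} where

  private
    g : ℤ
    g = gcd x (+ q)

    instance
      g-pos : ℤ.Positive g
      g-pos = ℤ.positive (ℤ.+<+ (ℕP.n≢0⇒n>0 (gcd[m,n]≢0 ℤ.∣ x ∣ q (inj₂ (ℕ.≢-nonZero⁻¹ q)))))

    scale : ∀ m → m ℤ.* ↧ (x / q) ℤ.* g ≡ m ℤ.* + q
    scale m = trans (ℤP.*-assoc m _ g) (cong (m ℤ.*_) (ℚP.↧-/ x q))

  [x/q]*q≤x : flr x q ℤ.* + q ℤ.≤ x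
  [x/q]*q≤x = subst₂ ℤ._≤_ (scale (flr x q)) (ℚP.↥-/ x q)
                (ℤP.*-monoʳ-≤-nonNeg g (floor*↧≤↥ (x / q)))

  x<suc[x/q]*q : x ℤ.< ℤ.suc (flr x q) ℤ.* + q
  x<suc[x/q]*q = subst₂ ℤ._<_ (ℚP.↥-/ x q) (scale (ℤ.suc (flr x q)))
                   (ℤP.*-monoʳ-<-pos g (↥<suc[floor]*↧ (x / q)))

  [x/q]*q<x : ¬ (+ q ∣ℤ x) → flr x q ℤ.* + q ℤ.< x
  [x/q]*q<x q∤x = ℤP.≤∧≢⇒< [x/q]*q≤x λ [x/q]*q≡x →
    q∤x (ℕ.divides ℤ.∣ flr x q ∣ (trans (cong ℤ.∣_∣ (sym [x/q]*q≡x)) (ℤP.abs-* (flr x q) (+ q))))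

module _ {q : ℕ} .{{_ : ℕ.NonZero q}} where

  ≤[x/q] : ∀ {m x} → m ℤ.* + q ℤ.≤ x → m ℤ.≤ flr x q
  ≤[x/q] {m} {x} m*q≤x = ℤP.≮⇒≥ λ [x/q]<m → ℤP.<⇒≱ (x<suc[x/q]*q x q)
    (ℤP.≤-trans (ℤP.*-monoʳ-≤-nonNeg (+ q) (ℤP.i<j⇒suc[i]≤j [x/q]<m)) m*q≤x)

  [x/q]≤ : ∀ {m x} → x ℤ.< ℤ.suc m ℤ.* + q → flr x q ℤ.≤ m
  [x/q]≤ {m} {x} x<suc[m]*q = ℤP.≮⇒≥ λ m<[x/q] → ℤP.<⇒≱ x<suc[m]*q
    (ℤP.≤-trans (ℤP.*-monoʳ-≤-nonNeg (+ q) (ℤP.i<j⇒suc[i]≤j m<[x/q])) ([x/q]*q≤x x q))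

  [x/q]-unique : ∀ {m x} → m ℤ.* + q ℤ.≤ x → x ℤ.< ℤ.suc m ℤ.* + q → flr x q ≡ m
  [x/q]-unique m*q≤x x<suc[m]*q = ℤP.≤-antisym ([x/q]≤ x<suc[m]*q) (≤[x/q] m*q≤x)

  [x+kq/q]≡[x/q]+k : ∀ x k → flr (x ℤ.+ k ℤ.* + q) q ≡ flr x q ℤ.+ k
  [x+kq/q]≡[x/q]+k x k = [x/q]-unique
    (subst (ℤ._≤ x ℤ.+ k ℤ.* + q) (sym (ℤP.*-distribʳ-+ (+ q) (flr x q) k))
      (ℤP.+-monoˡ-≤ (k ℤ.* + q) ([x/q]*q≤x x q)))
    (subst (x ℤ.+ k ℤ.* + q ℤ.<_) (shift (flr x q) k (+ q))
      (ℤP.+-monoˡ-< (k ℤ.* + q) (x<suc[x/q]*q x q)))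
    where
    shift : ∀ f k q → (+ 1 ℤ.+ f) ℤ.* q ℤ.+ k ℤ.* q ≡ (+ 1 ℤ.+ (f ℤ.+ k)) ℤ.* q
    shift = solve-∀

∃[i<2]q∤1+i+n : ∀ {q} → 2 ℕ.≤ q → ∀ n → ∃[ i ] i ℕ.< 2 × ¬ q ℕ.∣ suc (i + n)
∃[i<2]q∤1+i+n {q} 2≤q n with q ℕ.∣? suc n
... | no  q∤1+n = 0 , ℕ.z<s , q∤1+n
... | yes q∣1+n = 1 , ℕP.n<1+n 1 , λ q∣2+n →
  ℕP.<⇒≢ 2≤q (sym (ℕ.∣1⇒≡1 (ℕ.∣m+n∣m⇒∣n (subst (q ℕ.∣_) (ℕP.+-comm 1 (suc n)) q∣2+n) q∣1+n)))

module _ (p : ℤ) (q : ℕ) .{{_ : ℕ.NonZero q}} where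

  [kp/q]/k≤p/q : ∀ k .{{_ : ℕ.NonZero k}} → flr (+ k ℤ.* p) q / k ℚ.≤ p / q
  [kp/q]/k≤p/q k = *≤*⇒/≤/ (flr (+ k ℤ.* p) q) p
    (subst (flr (+ k ℤ.* p) q ℤ.* + q ℤ.≤_) (ℤP.*-comm (+ k) p) ([x/q]*q≤x (+ k ℤ.* p) q))

  [kp/q]/k<p/q : Coprime p (+ q) → ∀ k .{{_ : ℕ.NonZero k}} → ¬ q ℕ.∣ k →
                 flr (+ k ℤ.* p) q / k ℚ.< p / q
  [kp/q]/k<p/q cop k q∤k = *<*⇒/</ (flr (+ k ℤ.* p) q) p
    (subst (flr (+ k ℤ.* p) q ℤ.* + q ℤ.<_) (ℤP.*-comm (+ k) p) ([x/q]*q<x (+ k ℤ.* p) q λ q∣kp →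
      q∤k (Coprimality.coprime-divisor (+ q) p (+ k) (Coprimality.sym {p} {+ q} cop)
            (subst (+ q ∣ℤ_) (ℤP.*-comm (+ k) p) q∣kp))))

  s+jp/q+p/q≡s+[1+j]p/q : ∀ s j → s ℚ.+ (+ j ℤ.* p) / q ℚ.+ p / q ≡ s ℚ.+ (+ suc j ℤ.* p) / q
  s+jp/q+p/q≡s+[1+j]p/q s j = begin
    s ℚ.+ (+ j ℤ.* p) / q ℚ.+ p / q   ≡⟨ ℚP.+-assoc s _ _ ⟩
    s ℚ.+ ((+ j ℤ.* p) / q ℚ.+ p / q) ≡⟨ cong (s ℚ.+_) (/-distribʳ-+ (+ j ℤ.* p) p q) ⟨
    s ℚ.+ (+ j ℤ.* p ℤ.+ p) / q        ≡⟨ cong (λ x → s ℚ.+ x / q) (suc-* (+ j) p) ⟨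
    s ℚ.+ (+ suc j ℤ.* p) / q          ∎
    where
    open ≡-Reasoning
    suc-* : ∀ j p → (+ 1 ℤ.+ j) ℤ.* p ≡ j ℤ.* p ℤ.+ p
    suc-* = solve-∀

  S[j+m]≤S[m]+jp/q : ∀ j m → S p q (j + m) ℚ.≤ S p q m ℚ.+ (+ j ℤ.* p) / q
  S[j+m]≤S[m]+jp/q ℕ.zero m = ℚP.≤-reflexive (sym (trans (cong (S p q m ℚ.+_) (ℚP.0/n≡0 q))
                                                          (ℚP.+-identityʳ (S p q m))))
  S[j+m]≤S[m]+jp/q (suc j) m = ℚP.≤-trans
    (ℚP.+-mono-≤ (S[j+m]≤S[m]+jp/q j m) ([kp/q]/k≤p/q (suc (j + m))))
    (ℚP.≤-reflexive (s+jp/q+p/q≡s+[1+j]p/q (S p q m) j))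

  S[j+m]<S[m]+jp/q : Coprime p (+ q) → ∀ {i} j m → i ℕ.< j → ¬ q ℕ.∣ suc (i + m) →
                     S p q (j + m) ℚ.< S p q m ℚ.+ (+ j ℤ.* p) / q
  S[j+m]<S[m]+jp/q cop (suc j) m i<1+j q∤ = ℚP.<-≤-trans (step (ℕP.m<1+n⇒m<n∨m≡n i<1+j))
    (ℚP.≤-reflexive (s+jp/q+p/q≡s+[1+j]p/q (S p q m) j))
    where
    step : _ ⊎ _ → S p q (suc j + m) ℚ.< S p q m ℚ.+ (+ j ℤ.* p) / q ℚ.+ p / q
    step (inj₁ i<j)  = ℚP.+-mono-<-≤ (S[j+m]<S[m]+jp/q cop j m i<j q∤) ([kp/q]/k≤p/q (suc (j + m)))
    step (inj₂ refl) = ℚP.+-mono-≤-< (S[j+m]≤S[m]+jp/q j m) ([kp/q]/k<p/q cop (suc (j + m)) q∤)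

  S[q+n]<S[n]+p : Coprime p (+ q) → q ≥ 2 → ∀ n → S p q (q + n) ℚ.< S p q n ℚ.+ p / 1
  S[q+n]<S[n]+p cop q≥2 n with ∃[i<2]q∤1+i+n q≥2 n
  ... | i , i<2 , q∤1+i+n = subst (S p q (q + n) ℚ.<_) (cong (S p q n ℚ.+_) (k*i/k≡i p q))
    (S[j+m]<S[m]+jp/q cop q n (ℕP.<-≤-trans i<2 q≥2) q∤1+i+n)

lemma3p4 : (p : ℤ) (q : ℕ) .{{_ : ℕ.NonZero q}} → Coprime p (+ q) → q ≥ 2 →
    (n : ℕ) → n ≥ 1 → F p q n < F p q (n + q)
lemma3p4 p q cop q≥2 n _ = begin-strict
  a / 1 ℚ.- S p q n                              ≡⟨ cancel (a / 1) (S p q n) (p / 1) ⟩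
  (a / 1 ℚ.+ p / 1) ℚ.- (S p q n ℚ.+ p / 1)      <⟨ ℚP.+-monoʳ-< (a / 1 ℚ.+ p / 1)
                                                      (ℚP.neg-antimono-< (S[q+n]<S[n]+p p q cop q≥2 n)) ⟩
  (a / 1 ℚ.+ p / 1) ℚ.- S p q (q + n)            ≡⟨ cong₂ (λ x m → x ℚ.- S p q m)
                                                      (sym [n+q]p/q≡a+p) (ℕP.+-comm q n) ⟩
  flr (+ (n + q) ℤ.* p) q / 1 ℚ.- S p q (n + q)  ∎
  where
  open ℚP.≤-Reasoning
  open +-*-Solver
  a : ℤ
  a = flr (+ n ℤ.* p) q
  cancel : ∀ a s x → a ℚ.- s ≡ (a ℚ.+ x) ℚ.- (s ℚ.+ x)
  cancel = solve 3 (λ a s x → a :- s := (a :+ x) :- (s :+ x)) refl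
  [n+q]p/q≡a+p : flr (+ (n + q) ℤ.* p) q / 1 ≡ a / 1 ℚ.+ p / 1
  [n+q]p/q≡a+p = trans (cong (λ x → flr x q / 1) (expand (+ n) (+ q) p))
    (trans (cong (_/ 1) ([x+kq/q]≡[x/q]+k (+ n ℤ.* p) p)) (/-distribʳ-+ a p 1))
    where
    expand : ∀ n q p → (n ℤ.+ q) ℤ.* p ≡ n ℤ.* p ℤ.+ p ℤ.* q
    expand = solve-∀
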